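{- Let $\mathcal{S}\subseteq 2^{[n]}$ be a nonempty Sperner family and $A\subseteq[n]$ a fixed set, and let $h_A:\mathcal{S}\to 2^{[n]}$ be $h_A(S)=S\cap A$. Then $\mathcal{F}(\mathcal{S},h_A)$ is s-extremal, and there exists $F\notin\mathcal{F}(\mathcal{S},h_A)$ such that $\mathcal{F}'=\mathcal{F}(\mathcal{S},h_A)\cup\{F\}$ is again s-extremal. Moreover $\mathcal{F}'=\mathcal{F}(\mathcal{S}',h_A)$ for some Sperner family $\mathcal{S}'\subseteq 2^{[n]}$, where $h_A(S)=S\cap A$ for $S\in\mathcal{S}'$.
   Context: $[n]=\{1,\dots,n\}$. A family $\mathcal{F}\subseteq 2^{[n]}$ shatters $S\subseteq[n]$ if $\{F\cap S: F\in\mathcal{F}\}=2^S$; $\mathrm{Sh}(\mathcal{F})$ is the family of sets shattered by $\mathcal{F}$. $\mathcal{F}$ is s-extremal if $|\mathrm{Sh}(\mathcal{F})|=|\mathcal{F}|$. A Sperner family is a family none of whose members contains another. For $H\subseteq S\subseteq[n]$ let $\mathcal{Q}_{S,H}=\{H\cup B: B\subseteq[n]\setminus S\}$, and for a Sperner family $\mathcal{S}$ and $h$ with $h(S)\subseteq S$ define $\mathcal{F}(\mathcal{S},h)=2^{[n]}\setminus\bigcup_{S\in\mathcal{S}}\mathcal{Q}_{S,h(S)}$. -}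

module Defs where

open import Data.Nat using (ℕ; zero; suc)
open import Data.Bool using (Bool; true; false; not; _∧_; _∨_)
open import Data.Bool.ListAction using (any; all)
import Data.Bool.Properties as BoolP
open import Data.Vec using (Vec; []; _∷_)
open import Data.Vec.Properties using (≡-dec)
open import Data.List using (List; []; _∷_; _++_; map; filter; length)
open import Data.Fin.Subset using (Subset; _∩_; _∪_; _⊆_; outside; inside)
open import Data.Fin.Subset.Properties using (_⊆?_)
import Data.Fin.Subset as Sub
open import Relation.Nullary.Decidable using (⌊_⌋)
open import Relation.Binary.PropositionalEquality using (_≡_)

-- all 2^n subsets of [n] = Fin n, each exactly once
allSubsets : (n : ℕ) → List (Subset n)
allSubsets zero = [] ∷ []
allSubsets (suc n) = map (outside ∷_) (allSubsets n) ++ map (inside ∷_) (allSubsets n)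

_==_ : ∀ {n} → Subset n → Subset n → Bool
X == Y = ⌊ ≡-dec BoolP._≟_ X Y ⌋

Family : ℕ → Set
Family n = Subset n → Bool

card : ∀ {n} → Family n → ℕ
card {n} F = length (filter (λ X → F X BoolP.≟ true) (allSubsets n))

shatters : ∀ {n} → Family n → Subset n → Bool
shatters {n} F S =
  all (λ T → not ⌊ T ⊆? S ⌋ ∨ any (λ G → F G ∧ ((G ∩ S) == T)) (allSubsets n))
      (allSubsets n)

Sh : ∀ {n} → Family n → Family n
Sh F = shatters F

sExtremal : ∀ {n} → Family n → Set
sExtremal F = card (Sh F) ≡ card F

Sperner : ∀ {n} → Family n → Set
Sperner {n} 𝒮 = ∀ (S T : Subset n) → 𝒮 S ≡ true → 𝒮 T ≡ true → S ⊆ T → S ≡ T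

inQ : ∀ {n} → Subset n → Subset n → Subset n → Bool
inQ {n} S H X = any (λ B → ((B ∩ S) == Sub.⊥) ∧ (X == (H ∪ B))) (allSubsets n)

FSh : ∀ {n} → Family n → (Subset n → Subset n) → Family n
FSh {n} 𝒮 h X = not (any (λ S → 𝒮 S ∧ inQ S (h S) X) (allSubsets n))

hA : ∀ {n} → Subset n → Subset n → Subset n
hA A S = S ∩ A

addSet : ∀ {n} → Family n → Subset n → Family n
addSet F G X = F X ∨ (X == G)

-- Write X ⊕ A for symmetric difference. X lies in Q_{S, S∩A} iff X agrees with A on S,
-- i.e. (X ⊕ A) ∩ S = ∅, so F is the translate X ↦ Tr 𝒮 (X ⊕ A) of the up-closed family
-- Tr 𝒮 of transversals of 𝒮 (sets meeting every member).  The proof rests on three facts: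
--   * a translate of an up-closed U shatters S iff ∁ S ∈ U; hence Sh F is itself a
--     translate of F and, translations being bijections of 2^[n], F is s-extremal;
--   * every up-closed U is the transversal family of a Sperner family, its minimal
--     obstacles (inclusion-minimal S with ∁ S ∉ U);
--   * for S₀ ∈ 𝒮, adding ∁ S₀ to Tr 𝒮 keeps it up-closed, because 𝒮 is Sperner.
module Submission where

open import Data.Nat using (ℕ; suc; _+_)
open import Data.Nat.Properties using (+-comm)
open import Data.Bool using (Bool; true; false; not; _∧_; _∨_; _xor_)
open import Data.Bool.Properties as BoolP
  using (T-≡; ∧-conicalˡ; ∧-conicalʳ; ∧-zeroʳ; ∨-zeroʳ; not-injective; not-¬; ¬-not;
         xor-assoc; xor-same; xor-identityʳ; not-distribˡ-xor; not-distribʳ-xor)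
open import Data.Bool.ListAction using (or; any; all)
open import Data.Vec using ([]; _∷_; zipWith)
open import Data.Vec.Properties using (≡-dec; ∷-injectiveˡ; ∷-injectiveʳ)
open import Data.List using (List; []; _∷_; _++_; map; filter; length)
open import Data.List.Properties using (filter-++; length-++; filter-≐; map-cong)
open import Data.List.Membership.Propositional using (lose) renaming (_∈_ to _∈ₗ_)
open import Data.List.Membership.Propositional.Properties using (∈-map⁺; ∈-++⁺ˡ; ∈-++⁺ʳ)
open import Data.List.Relation.Unary.Any using (here; satisfied)
open import Data.List.Relation.Unary.Any.Properties using (any⁺; any⁻)
import Data.List.Relation.Unary.All as All
open import Data.List.Relation.Unary.All.Properties using (all⁺; all⁻)
open import Data.Fin.Subset
  using (Subset; _∩_; _∪_; ∁; _∈_; _∉_; _⊆_; _⊂_; outside; inside) renaming (⊥ to ∅)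
open import Data.Fin using (Fin)
open import Data.Fin.Properties using (any?)
open import Data.Fin.Subset.Properties
  using (_⊆?_; _⊂?_; _∈?_; ⊆-refl; ⊆-trans; ⊆-antisym; p⊂q⇒p⊆q; p∩q⊆p; p⊆p∪q; x∈p∩q⁺; x∈p∩q⁻; ∉⊥;
         Empty-unique; x∉p⇒x∈∁p; x∈∁p⇒x∉p; x∉∁p⇒x∈p; ∩-inverseˡ; ∪-∩-booleanAlgebra)
import Algebra.Lattice.Properties.BooleanAlgebra as BA
open import Data.Fin.Subset.Induction using (⊂-wellFounded)
open import Induction.WellFounded using (Acc; acc)
open import Data.Product using (Σ; ∃; _×_; _,_; proj₂)
open import Function using (_∘_; Equivalence)
open import Relation.Nullary using (Dec; yes; no; ¬_; ¬?; contradiction)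
open import Relation.Nullary.Decidable using (⌊_⌋; _×-dec_; decidable-stable)
open import Relation.Binary.PropositionalEquality
  using (_≡_; _≢_; refl; sym; trans; cong; cong₂; subst; module ≡-Reasoning)

open import Defs

private
  variable
    n : ℕ

⌊⌋-true⇒ : {P : Set} (d : Dec P) → ⌊ d ⌋ ≡ true → P
⌊⌋-true⇒ (yes p) _ = p

⌊⌋-true : {P : Set} (d : Dec P) → P → ⌊ d ⌋ ≡ true
⌊⌋-true (yes _) _ = refl
⌊⌋-true (no ¬p) p = contradiction p ¬p

==⇒≡ : {X Y : Subset n} → (X == Y) ≡ true → X ≡ Y
==⇒≡ {X = X} {Y} = ⌊⌋-true⇒ (≡-dec BoolP._≟_ X Y)

≡⇒== : {X Y : Subset n} → X ≡ Y → (X == Y) ≡ true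
≡⇒== {X = X} {Y} = ⌊⌋-true (≡-dec BoolP._≟_ X Y)

bool-ext : {a b : Bool} → (a ≡ true → b ≡ true) → (b ≡ true → a ≡ true) → a ≡ b
bool-ext {true}  a⇒b _ = sym (a⇒b refl)
bool-ext {false} {false} _ _ = refl
bool-ext {false} {true}  _ b⇒a = b⇒a refl

allSubsets-complete : (X : Subset n) → X ∈ₗ allSubsets n
allSubsets-complete [] = here refl
allSubsets-complete {suc n} (outside ∷ X) = ∈-++⁺ˡ (∈-map⁺ (outside ∷_) (allSubsets-complete X))
allSubsets-complete {suc n} (inside ∷ X) =
  ∈-++⁺ʳ (map (outside ∷_) (allSubsets n)) (∈-map⁺ (inside ∷_) (allSubsets-complete X))

any-intro : (p : Subset n → Bool) (X : Subset n) → p X ≡ true → any p (allSubsets n) ≡ true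
any-intro p X pX =
  Equivalence.to T-≡ (any⁺ p (lose (allSubsets-complete X) (Equivalence.from T-≡ pX)))

any-elim : (p : Subset n → Bool) → any p (allSubsets n) ≡ true → ∃ λ X → p X ≡ true
any-elim {n} p h with satisfied (any⁻ p (allSubsets n) (Equivalence.from T-≡ h))
... | X , pX = X , Equivalence.to T-≡ pX

all-intro : (p : Subset n → Bool) → (∀ X → p X ≡ true) → all p (allSubsets n) ≡ true
all-intro {n} p ∀p =
  Equivalence.to T-≡ (all⁻ p {allSubsets n} (All.tabulate λ {X} _ → Equivalence.from T-≡ (∀p X)))

all-elim : (p : Subset n → Bool) → all p (allSubsets n) ≡ true → ∀ X → p X ≡ true
all-elim {n} p h X =
  Equivalence.to T-≡
    (All.lookup (all⁺ p (allSubsets n) (Equivalence.from T-≡ h)) (allSubsets-complete X))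

infixl 6 _⊕_

_⊕_ : Subset n → Subset n → Subset n
_⊕_ = zipWith _xor_

⊕-involutive : (X A : Subset n) → (X ⊕ A) ⊕ A ≡ X
⊕-involutive [] [] = refl
⊕-involutive (x ∷ X) (a ∷ A) = cong₂ _∷_ xor-cancel (⊕-involutive X A)
  where
  xor-cancel : (x xor a) xor a ≡ x
  xor-cancel = trans (xor-assoc x a a) (trans (cong (x xor_) (xor-same a)) (xor-identityʳ x))

∁-⊕ : (X A : Subset n) → ∁ X ⊕ A ≡ X ⊕ ∁ A
∁-⊕ [] [] = refl
∁-⊕ (x ∷ X) (a ∷ A) =
  cong₂ _∷_ (trans (sym (not-distribˡ-xor x a)) (not-distribʳ-xor x a)) (∁-⊕ X A)

AgreeOn : Subset n → Subset n → Subset n → Set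
AgreeOn S X A = (X ⊕ A) ∩ S ≡ ∅

Q-member-agrees : (S A B : Subset n) → B ∩ S ≡ ∅ → AgreeOn S ((S ∩ A) ∪ B) A
Q-member-agrees [] [] [] _ = refl
Q-member-agrees (s ∷ S) (a ∷ A) (b ∷ B) eq =
  cong₂ _∷_ (head s a b (∷-injectiveˡ eq)) (Q-member-agrees S A B (∷-injectiveʳ eq))
  where
  head : ∀ s a b → b ∧ s ≡ false → ((s ∧ a ∨ b) xor a) ∧ s ≡ false
  head false a     b     _ = ∧-zeroʳ (b xor a)
  head true  false false _ = refl
  head true  true  false _ = refl

agreeing-decompose : (X S A : Subset n) → AgreeOn S X A → X ≡ (S ∩ A) ∪ (X ∩ ∁ S)
agreeing-decompose [] [] [] _ = refl
agreeing-decompose (x ∷ X) (s ∷ S) (a ∷ A) eq =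
  cong₂ _∷_ (head x s a (∷-injectiveˡ eq)) (agreeing-decompose X S A (∷-injectiveʳ eq))
  where
  head : ∀ x s a → (x xor a) ∧ s ≡ false → x ≡ (s ∧ a) ∨ (x ∧ not s)
  head false false a     _ = refl
  head true  false a     _ = refl
  head false true  false _ = refl
  head true  true  true  _ = refl

trace-agrees : (G S A : Subset n) → G ∩ S ≡ S ∩ A → AgreeOn S G A
trace-agrees [] [] [] _ = refl
trace-agrees (g ∷ G) (s ∷ S) (a ∷ A) eq =
  cong₂ _∷_ (head g s a (∷-injectiveˡ eq)) (trace-agrees G S A (∷-injectiveʳ eq))
  where
  head : ∀ g s a → g ∧ s ≡ s ∧ a → (g xor a) ∧ s ≡ false
  head g     false a     _ = ∧-zeroʳ (g xor a)
  head false true  false _ = refl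
  head true  true  true  _ = refl

trace-of-lift : (S T A : Subset n) → ((∁ S ∪ (T ⊕ A)) ⊕ A) ∩ S ≡ T ∩ S
trace-of-lift [] [] [] = refl
trace-of-lift (s ∷ S) (t ∷ T) (a ∷ A) = cong₂ _∷_ (head s t a) (trace-of-lift S T A)
  where
  head : ∀ s t a → ((not s ∨ (t xor a)) xor a) ∧ s ≡ t ∧ s
  head false t     a     = trans (∧-zeroʳ _) (sym (∧-zeroʳ t))
  head true  false false = refl
  head true  false true  = refl
  head true  true  false = refl
  head true  true  true  = refl

card-cong : {F G : Family n} → (∀ X → F X ≡ G X) → card F ≡ card G
card-cong {n} {F} {G} F≗G =
  cong length (filter-≐ (λ X → F X BoolP.≟ true) (λ X → G X BoolP.≟ true)
                        ((λ {X} h → trans (sym (F≗G X)) h) , (λ {X} h → trans (F≗G X) h))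
                        (allSubsets n))

count-map : {m : ℕ} (F : Family n) (f : Subset m → Subset n) (xs : List (Subset m)) →
  length (filter (λ X → F X BoolP.≟ true) (map f xs))
    ≡ length (filter (λ X → F (f X) BoolP.≟ true) xs)
count-map F f [] = refl
count-map F f (x ∷ xs) with F (f x)
... | true  = cong suc (count-map F f xs)
... | false = count-map F f xs

card-split : (F : Family (suc n)) → card F ≡ card (F ∘ (outside ∷_)) + card (F ∘ (inside ∷_))
card-split {n} F = begin
  card F
    ≡⟨ cong length (filter-++ P? (map (outside ∷_) L) (map (inside ∷_) L)) ⟩
  length (filter P? (map (outside ∷_) L) ++ filter P? (map (inside ∷_) L))
    ≡⟨ length-++ (filter P? (map (outside ∷_) L)) ⟩
  length (filter P? (map (outside ∷_) L)) + length (filter P? (map (inside ∷_) L))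
    ≡⟨ cong₂ _+_ (count-map F (outside ∷_) L) (count-map F (inside ∷_) L) ⟩
  card (F ∘ (outside ∷_)) + card (F ∘ (inside ∷_)) ∎
  where
  open ≡-Reasoning
  L : List (Subset n)
  L = allSubsets n
  P? : (X : Subset (suc n)) → Dec (F X ≡ true)
  P? X = F X BoolP.≟ true

card-translate : (v : Subset n) (F : Family n) → card (λ X → F (X ⊕ v)) ≡ card F
card-translate [] F = card-cong {F = λ X → F (X ⊕ [])} {G = F} λ { [] → refl }
card-translate (outside ∷ v) F = begin
  card (λ X → F (X ⊕ (outside ∷ v)))
    ≡⟨ card-split (λ X → F (X ⊕ _)) ⟩
  card (λ X → F (outside ∷ X ⊕ v)) + card (λ X → F (inside ∷ X ⊕ v))
    ≡⟨ cong₂ _+_ (card-translate v (F ∘ (outside ∷_))) (card-translate v (F ∘ (inside ∷_))) ⟩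
  card (F ∘ (outside ∷_)) + card (F ∘ (inside ∷_))
    ≡⟨ card-split F ⟨
  card F ∎
  where open ≡-Reasoning
card-translate (inside ∷ v) F = begin
  card (λ X → F (X ⊕ (inside ∷ v)))
    ≡⟨ card-split (λ X → F (X ⊕ _)) ⟩
  card (λ X → F (inside ∷ X ⊕ v)) + card (λ X → F (outside ∷ X ⊕ v))
    ≡⟨ cong₂ _+_ (card-translate v (F ∘ (inside ∷_))) (card-translate v (F ∘ (outside ∷_))) ⟩
  card (F ∘ (inside ∷_)) + card (F ∘ (outside ∷_))
    ≡⟨ +-comm (card (F ∘ (inside ∷_))) _ ⟩
  card (F ∘ (outside ∷_)) + card (F ∘ (inside ∷_))
    ≡⟨ card-split F ⟨
  card F ∎
  where open ≡-Reasoning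

disjoint-intro : {Y S : Subset n} → (∀ {x} → x ∈ Y → x ∉ S) → Y ∩ S ≡ ∅
disjoint-intro {Y = Y} {S} apart = Empty-unique λ (x , x∈Y∩S) →
  let x∈Y , x∈S = x∈p∩q⁻ Y S x∈Y∩S in apart x∈Y x∈S

disjoint-elim : {Y S : Subset n} {x : Fin n} → Y ∩ S ≡ ∅ → x ∈ Y → x ∉ S
disjoint-elim {x = x} Y∩S≡∅ x∈Y x∈S = ∉⊥ (subst (x ∈_) Y∩S≡∅ (x∈p∩q⁺ (x∈Y , x∈S)))

disjoint⇒⊆∁ : {Y S : Subset n} → Y ∩ S ≡ ∅ → Y ⊆ ∁ S
disjoint⇒⊆∁ Y∩S≡∅ x∈Y = x∉p⇒x∈∁p (disjoint-elim Y∩S≡∅ x∈Y)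

⊆⇒∩≡ : {T S : Subset n} → T ⊆ S → T ∩ S ≡ T
⊆⇒∩≡ {T = T} {S} T⊆S = ⊆-antisym (p∩q⊆p T S) (λ x∈T → x∈p∩q⁺ (x∈T , T⊆S x∈T))

⊆∧≢⇒⊂ : {S T : Subset n} → S ⊆ T → S ≢ T → S ⊂ T
⊆∧≢⇒⊂ {S = S} {T} S⊆T S≢T with any? (λ x → x ∈? T ×-dec ¬? (x ∈? S))
... | yes (x , x∈T , x∉S) = S⊆T , x , x∈T , x∉S
... | no ∄new = contradiction (⊆-antisym S⊆T T⊆S) S≢T
  where
  T⊆S : T ⊆ S
  T⊆S {x} x∈T = decidable-stable (x ∈? S) λ x∉S → ∄new (x , x∈T , x∉S)

∁-involutive : (X : Subset n) → ∁ (∁ X) ≡ X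
∁-involutive {n} = BA.¬-involutive (∪-∩-booleanAlgebra n)

Tr : Family n → Family n
Tr {n} 𝒮 Y = not (any (λ S → 𝒮 S ∧ ((Y ∩ S) == ∅)) (allSubsets n))

Tr-false⇒ : (𝒮 : Family n) (Y : Subset n) → Tr 𝒮 Y ≡ false → ∃ λ S → 𝒮 S ≡ true × Y ∩ S ≡ ∅
Tr-false⇒ 𝒮 Y TrY≡false with any-elim _ (not-injective TrY≡false)
... | S , h = S , ∧-conicalˡ _ _ h , ==⇒≡ (∧-conicalʳ _ _ h)

Tr-false : (𝒮 : Family n) {Y S : Subset n} → 𝒮 S ≡ true → Y ∩ S ≡ ∅ → Tr 𝒮 Y ≡ false
Tr-false 𝒮 {Y} {S} S∈𝒮 Y∩S≡∅ = cong not (any-intro _ S (cong₂ _∧_ S∈𝒮 (≡⇒== Y∩S≡∅)))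

UpClosed : Family n → Set
UpClosed {n} U = {Y Y' : Subset n} → Y ⊆ Y' → U Y ≡ true → U Y' ≡ true

Tr-upClosed : (𝒮 : Family n) → UpClosed (Tr 𝒮)
Tr-upClosed 𝒮 {Y} {Y'} Y⊆Y' TrY = ¬-not λ TrY'≡false →
  let S , S∈𝒮 , Y'∩S≡∅ = Tr-false⇒ 𝒮 Y' TrY'≡false
  in not-¬ TrY (Tr-false 𝒮 S∈𝒮 (disjoint-intro (disjoint-elim Y'∩S≡∅ ∘ Y⊆Y')))

inQ-hA : (S A X : Subset n) → inQ S (S ∩ A) X ≡ (((X ⊕ A) ∩ S) == ∅)
inQ-hA {n} S A X = bool-ext inQ⇒agree agree⇒inQ
  where
  agree⇒inQ : (((X ⊕ A) ∩ S) == ∅) ≡ true → inQ S (S ∩ A) X ≡ true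
  agree⇒inQ agree = any-intro _ (X ∩ ∁ S)
    (cong₂ _∧_ (≡⇒== (disjoint-intro (x∈∁p⇒x∉p ∘ proj₂ ∘ x∈p∩q⁻ X (∁ S))))
               (≡⇒== (agreeing-decompose X S A (==⇒≡ agree))))
  inQ⇒agree : inQ S (S ∩ A) X ≡ true → (((X ⊕ A) ∩ S) == ∅) ≡ true
  inQ⇒agree h with any-elim _ h
  ... | B , B∩S∧X≡ = ≡⇒== (subst (λ Z → AgreeOn S Z A) (sym (==⇒≡ (∧-conicalʳ _ _ B∩S∧X≡)))
                                 (Q-member-agrees S A B (==⇒≡ (∧-conicalˡ _ _ B∩S∧X≡))))

FSh-hA : (𝒮 : Family n) (A X : Subset n) → FSh 𝒮 (hA A) X ≡ Tr 𝒮 (X ⊕ A)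
FSh-hA {n} 𝒮 A X = cong (not ∘ or) (map-cong (λ S → cong (𝒮 S ∧_) (inQ-hA S A X)) (allSubsets n))

traces : Family n → Subset n → Subset n → Bool
traces {n} F S T = any (λ G → F G ∧ ((G ∩ S) == T)) (allSubsets n)

-- A translate F of an up-closed U shatters S iff ∁ S ∈ U: the trace S ∩ A forces some
-- G ⊕ A ⊆ ∁ S into U, and conversely every T ⊆ S is the trace of a lift of ∁ S ∪ (T ⊕ A).
shatters-translate : (U : Family n) → UpClosed U → (A : Subset n) (F : Family n) →
  (∀ X → F X ≡ U (X ⊕ A)) → (S : Subset n) → shatters F S ≡ U (∁ S)
shatters-translate {n} U up A F F≡U S = bool-ext shattered⇒ ⇒shattered
  where
  shattered-realises : shatters F S ≡ true → (T : Subset n) → T ⊆ S → traces F S T ≡ true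
  shattered-realises sh T T⊆S =
    subst (λ b → not b ∨ traces F S T ≡ true) (⌊⌋-true (T ⊆? S) T⊆S) (all-elim _ sh T)

  shattered⇒ : shatters F S ≡ true → U (∁ S) ≡ true
  shattered⇒ sh with any-elim _ (shattered-realises sh (S ∩ A) (p∩q⊆p S A))
  ... | G , G∈F∧trace =
    up (disjoint⇒⊆∁ (trace-agrees G S A (==⇒≡ (∧-conicalʳ _ _ G∈F∧trace))))
       (trans (sym (F≡U G)) (∧-conicalˡ _ _ G∈F∧trace))

  lift-realises : U (∁ S) ≡ true → (T : Subset n) → T ⊆ S → traces F S T ≡ true
  lift-realises ∁S∈U T T⊆S = any-intro _ (Y ⊕ A) (cong₂ _∧_ lift∈F (≡⇒== lift-trace))
    where
    Y : Subset n
    Y = ∁ S ∪ (T ⊕ A)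
    lift∈F : F (Y ⊕ A) ≡ true
    lift∈F = trans (F≡U (Y ⊕ A))
                   (subst (λ Z → U Z ≡ true) (sym (⊕-involutive Y A)) (up (p⊆p∪q (T ⊕ A)) ∁S∈U))
    lift-trace : (Y ⊕ A) ∩ S ≡ T
    lift-trace = trans (trace-of-lift S T A) (⊆⇒∩≡ T⊆S)

  ⇒shattered : U (∁ S) ≡ true → shatters F S ≡ true
  ⇒shattered ∁S∈U = all-intro _ realisable
    where
    realisable : (T : Subset n) → not ⌊ T ⊆? S ⌋ ∨ traces F S T ≡ true
    realisable T with T ⊆? S
    ... | yes T⊆S = lift-realises ∁S∈U T T⊆S
    ... | no  _   = refl

-- Every translate of an up-closed family is s-extremal: Sh F is again a translate of F.
translate-sExtremal : (U : Family n) → UpClosed U → (A : Subset n) (F : Family n) →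
  (∀ X → F X ≡ U (X ⊕ A)) → sExtremal F
translate-sExtremal U up A F F≡U = begin
  card (Sh F)               ≡⟨ card-cong Sh≡translate ⟩
  card (λ S → F (S ⊕ ∁ A)) ≡⟨ card-translate (∁ A) F ⟩
  card F                    ∎
  where
  open ≡-Reasoning
  Sh≡translate : ∀ S → Sh F S ≡ F (S ⊕ ∁ A)
  Sh≡translate S = begin
    Sh F S               ≡⟨ shatters-translate U up A F F≡U S ⟩
    U (∁ S)              ≡⟨ cong U (⊕-involutive (∁ S) A) ⟨
    U ((∁ S ⊕ A) ⊕ A)    ≡⟨ F≡U (∁ S ⊕ A) ⟨
    F (∁ S ⊕ A)          ≡⟨ cong F (∁-⊕ S A) ⟩
    F (S ⊕ ∁ A)          ∎

-- Every up-closed family U is the transversal family of a Sperner family, namely of its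
-- minimal obstacles: the inclusion-minimal sets S with ∁ S ∉ U.
module MinimalObstacles (U : Family n) where

  -- S is an obstacle when its complement is not in U, i.e. every member of U meets S.
  obstacle : Subset n → Bool
  obstacle S = not (U (∁ S))

  hasSmaller : Subset n → Bool
  hasSmaller S = any (λ T → ⌊ T ⊂? S ⌋ ∧ obstacle T) (allSubsets n)

  minimal : Family n
  minimal S = obstacle S ∧ not (hasSmaller S)

  -- Two nested minimal obstacles coincide: otherwise the smaller one witnesses hasSmaller.
  minimal-sperner : Sperner minimal
  minimal-sperner S T S-min T-min S⊆T with ≡-dec BoolP._≟_ S T
  ... | yes S≡T = S≡T
  ... | no  S≢T = contradiction (not-injective (∧-conicalʳ _ _ T-min)) (not-¬ T-smaller)
    where
    T-smaller : hasSmaller T ≡ true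
    T-smaller =
      any-intro _ S (cong₂ _∧_ (⌊⌋-true (S ⊂? T) (⊆∧≢⇒⊂ S⊆T S≢T)) (∧-conicalˡ _ _ S-min))

  minimal-below : (S : Subset n) → obstacle S ≡ true → ∃ λ S' → S' ⊆ S × minimal S' ≡ true
  minimal-below S = descend S (⊂-wellFounded S)
    where
    descend : (S : Subset n) → Acc _⊂_ S → obstacle S ≡ true →
              ∃ λ S' → S' ⊆ S × minimal S' ≡ true
    descend S (acc smaller) S-obs with hasSmaller S in eq
    ... | false = S , ⊆-refl , cong₂ (λ a b → a ∧ not b) S-obs eq
    ... | true with any-elim _ eq
    ...   | T , T⊂S∧T-obs =
      let S' , S'⊆T , S'-min = descend T (smaller T⊂S) (∧-conicalʳ _ _ T⊂S∧T-obs)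
      in S' , ⊆-trans S'⊆T (p⊂q⇒p⊆q T⊂S) , S'-min
      where
      T⊂S : T ⊂ S
      T⊂S = ⌊⌋-true⇒ (T ⊂? S) (∧-conicalˡ _ _ T⊂S∧T-obs)

  Tr-minimal : UpClosed U → (Y : Subset n) → Tr minimal Y ≡ U Y
  Tr-minimal up Y = bool-ext transversal⇒∈U ∈U⇒transversal
    where
    -- if Y ∉ U then ∁ Y is an obstacle, and a minimal obstacle inside ∁ Y misses Y
    transversal⇒∈U : Tr minimal Y ≡ true → U Y ≡ true
    transversal⇒∈U TrY = ¬-not λ Y∉U →
      let ∁Y-obs = cong not (trans (cong U (∁-involutive Y)) Y∉U)
          S' , S'⊆∁Y , S'-min = minimal-below (∁ Y) ∁Y-obs
      in not-¬ TrY (Tr-false minimal S'-min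
           (disjoint-intro λ x∈Y x∈S' → x∈∁p⇒x∉p (S'⊆∁Y x∈S') x∈Y))
    -- a member of U missing an obstacle S would put ∁ S into U
    ∈U⇒transversal : U Y ≡ true → Tr minimal Y ≡ true
    ∈U⇒transversal Y∈U = ¬-not λ TrY≡false →
      let S , S-min , Y∩S≡∅ = Tr-false⇒ minimal Y TrY≡false
      in not-¬ (up (disjoint⇒⊆∁ Y∩S≡∅) Y∈U) (not-injective (∧-conicalˡ _ _ S-min))

∨-introˡ : {a b : Bool} → a ≡ true → a ∨ b ≡ true
∨-introˡ {b = b} a≡true = cong (_∨ b) a≡true

insert-upClosed : (U : Family n) (Z : Subset n) → UpClosed U →
  ({Y : Subset n} → Z ⊆ Y → Y ≢ Z → U Y ≡ true) → UpClosed (addSet U Z)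
insert-upClosed U Z up above {Y} {Y'} Y⊆Y' Y∈U+Z with U Y in Y∈U | ≡-dec BoolP._≟_ Y' Z
... | true  | _        = ∨-introˡ (up Y⊆Y' Y∈U)
... | false | yes _    = ∨-zeroʳ (U Y')
... | false | no  Y'≢Z = ∨-introˡ (above (subst (_⊆ Y') (==⇒≡ Y∈U+Z) Y⊆Y') Y'≢Z)

-- If S₀ is a member of a Sperner family 𝒮, every proper superset Y of ∁ S₀ is a transversal:
-- a member R missed by Y satisfies R ⊆ ∁ Y ⊆ S₀, so R = S₀ and Y ⊆ ∁ S₀.
Tr-above-∁member : (𝒮 : Family n) → Sperner 𝒮 → {S₀ : Subset n} → 𝒮 S₀ ≡ true →
  {Y : Subset n} → ∁ S₀ ⊆ Y → Y ≢ ∁ S₀ → Tr 𝒮 Y ≡ true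
Tr-above-∁member {n} 𝒮 sperner {S₀} S₀∈𝒮 {Y} ∁S₀⊆Y Y≢∁S₀ = ¬-not λ TrY≡false →
  let R , R∈𝒮 , Y∩R≡∅ = Tr-false⇒ 𝒮 Y TrY≡false
      R≡S₀ = sperner R S₀ R∈𝒮 S₀∈𝒮 (missed⊆S₀ Y∩R≡∅)
  in Y≢∁S₀ (⊆-antisym (disjoint⇒⊆∁ (subst (λ R → Y ∩ R ≡ ∅) R≡S₀ Y∩R≡∅)) ∁S₀⊆Y)
  where
  missed⊆S₀ : {R : Subset n} → Y ∩ R ≡ ∅ → R ⊆ S₀
  missed⊆S₀ Y∩R≡∅ x∈R = x∉∁p⇒x∈p λ x∈∁S₀ → disjoint-elim Y∩R≡∅ (∁S₀⊆Y x∈∁S₀) x∈R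

==-translate : (X Z A : Subset n) → (X == (Z ⊕ A)) ≡ ((X ⊕ A) == Z)
==-translate X Z A = bool-ext
  (λ h → ≡⇒== (trans (cong (_⊕ A) (==⇒≡ h)) (⊕-involutive Z A)))
  (λ h → ≡⇒== (trans (sym (⊕-involutive X A)) (cong (_⊕ A) (==⇒≡ h))))

theorem9 : (n : ℕ) (𝒮 : Family n) → Sperner 𝒮 → (∃ λ S → 𝒮 S ≡ true) → (A : Subset n) →
    sExtremal (FSh 𝒮 (hA A))
    × (Σ (Subset n) λ F → FSh 𝒮 (hA A) F ≡ false
        × sExtremal (addSet (FSh 𝒮 (hA A)) F)
        × (Σ (Family n) λ 𝒮' → Sperner 𝒮'
            × (∀ X → addSet (FSh 𝒮 (hA A)) F X ≡ FSh 𝒮' (hA A) X)))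
theorem9 n 𝒮 sperner (S₀ , S₀∈𝒮) A =
    translate-sExtremal (Tr 𝒮) (Tr-upClosed 𝒮) A F (FSh-hA 𝒮 A)
  , F₀ , F₀∉F
  , translate-sExtremal U' U'-upClosed A F' F'≡U'
  , minimal , minimal-sperner
  , λ X → begin
      F' X                 ≡⟨ F'≡U' X ⟩
      U' (X ⊕ A)           ≡⟨ Tr-minimal U'-upClosed (X ⊕ A) ⟨
      Tr minimal (X ⊕ A)   ≡⟨ FSh-hA minimal A X ⟨
      FSh minimal (hA A) X ∎
  where
  open ≡-Reasoning
  F : Family n
  F = FSh 𝒮 (hA A)
  -- the added set: the translate of ∁ S₀, the largest set missing S₀
  F₀ : Subset n
  F₀ = ∁ S₀ ⊕ A
  F' : Family n
  F' = addSet F F₀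
  U' : Family n
  U' = addSet (Tr 𝒮) (∁ S₀)
  open MinimalObstacles U'

  F₀∉F : F F₀ ≡ false
  F₀∉F = trans (FSh-hA 𝒮 A F₀)
               (trans (cong (Tr 𝒮) (⊕-involutive (∁ S₀) A)) (Tr-false 𝒮 S₀∈𝒮 (∩-inverseˡ S₀)))

  U'-upClosed : UpClosed U'
  U'-upClosed = insert-upClosed (Tr 𝒮) (∁ S₀) (Tr-upClosed 𝒮) (Tr-above-∁member 𝒮 sperner S₀∈𝒮)

  F'≡U' : ∀ X → F' X ≡ U' (X ⊕ A)
  F'≡U' X = cong₂ _∨_ (FSh-hA 𝒮 A X) (==-translate X (∁ S₀) A)
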